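{- For every positive integer $n$, $\tau(n+1)\ge \rho(n)$.
   Context: The $d$-dimensional hypercube $Q_d$ has vertex set $\{0,1\}^d$. A subcube of $Q_d$ is a set of the form $\{x\in\{0,1\}^d : x_j=a_j \text{ for all } j\in J\}$ for some $J\subseteq\{1,\dots,d\}$ and constants $a_j\in\{0,1\}$; its dimension is $d-|J|$. The intersection graph of a family of sets has one vertex per set and an edge between two vertices iff the corresponding sets intersect. For a graph $G$, $\rho(G)$ is the least $d$ such that $G$ is the intersection graph of a family of subcubes of $Q_d$, and $\tau(G)$ is the least $r$ such that $G$ is the intersection graph of a family of subcubes, each of dimension exactly $r$, of some hypercube. For a positive integer $n$, $\rho(n)=\max\{\rho(G): |V(G)|=n\}$ and $\tau(n)=\max\{\tau(G): |V(G)|=n\}$. -}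

module Defs where

open import Data.Nat using (ℕ; zero; suc; _≤_)
open import Data.Fin using (Fin)
open import Data.Bool using (Bool; true; false)
open import Data.Maybe using (Maybe; just; nothing)
open import Data.Vec using (Vec; []; _∷_; lookup)
open import Data.Product using (Σ; ∃; _×_; _,_)
open import Relation.Binary.PropositionalEquality using (_≡_; _≢_)
open import Function.Bundles using (_⇔_)

record Graph (n : ℕ) : Set where
  field
    adj    : Fin n → Fin n → Bool
    sym    : ∀ u v → adj u v ≡ adj v u
    irrefl : ∀ u → adj u u ≡ false
open Graph public

Point : ℕ → Set
Point d = Vec Bool d

-- A subcube of Q_d: coordinate j is fixed to b (just b) or free (nothing).
-- The subcube {x : x_j = a_j for j ∈ J} is encoded with J = fixed coordinates.
Cube : ℕ → Set
Cube d = Vec (Maybe Bool) d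

_∈C_ : {d : ℕ} → Point d → Cube d → Set
_∈C_ {d} x c = ∀ (j : Fin d) (b : Bool) → lookup c j ≡ just b → lookup x j ≡ b

dim : {d : ℕ} → Cube d → ℕ
dim []              = zero
dim (nothing ∷ c)   = suc (dim c)
dim (just _  ∷ c)   = dim c

Meets : {d : ℕ} → Cube d → Cube d → Set
Meets {d} c c' = Σ (Point d) λ x → (x ∈C c) × (x ∈C c')

IsIntersectionGraph : {n d : ℕ} → Graph n → (Fin n → Cube d) → Set
IsIntersectionGraph {n} G f =
  ∀ (u v : Fin n) → u ≢ v → (adj G u v ≡ true) ⇔ Meets (f u) (f v)

CubeRep : {n : ℕ} → Graph n → ℕ → Set
CubeRep {n} G d = Σ (Fin n → Cube d) λ f → IsIntersectionGraph G f

UniformRep : {n : ℕ} → Graph n → ℕ → Set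
UniformRep {n} G r =
  Σ ℕ λ d → Σ (Fin n → Cube d) λ f →
    IsIntersectionGraph G f × (∀ v → dim (f v) ≡ r)

IsLeast : (ℕ → Set) → ℕ → Set
IsLeast P m = P m × (∀ k → P k → m ≤ k)

IsRhoG : {n : ℕ} → Graph n → ℕ → Set
IsRhoG G = IsLeast (CubeRep G)

IsTauG : {n : ℕ} → Graph n → ℕ → Set
IsTauG G = IsLeast (UniformRep G)

IsMaxOver : (n : ℕ) → (Graph n → ℕ → Set) → ℕ → Set
IsMaxOver n F m =
  (Σ (Graph n) λ G → F G m) × (∀ (G : Graph n) k → F G k → k ≤ m)

IsRhoN : ℕ → ℕ → Set
IsRhoN n = IsMaxOver n IsRhoG

IsTauN : ℕ → ℕ → Set
IsTauN n = IsMaxOver n IsTauG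

-- Let G attain ρ(n) = a and let H be G with a universal vertex added.
-- Following every coordinate of a subcube by a "twin" coordinate that is free
-- exactly when the original one is fixed turns a representation of G in Q_a
-- into subcubes of dimension exactly a of Q_{2a}; together with the padded
-- whole cube for the universal vertex this represents H, so τ(H) exists.
-- Conversely, in a representation of H by r-dimensional subcubes every cube
-- meets the cube w of the universal vertex, and by the Helly property of
-- subcubes two of them meet iff their traces on w meet. As w is a copy of Q_r,
-- ρ(n) = ρ(G) ≤ τ(H) ≤ τ(n+1).
module Submission where

open import Defs
open import Data.Nat using (ℕ; suc; _≤_; _≥_; _*_; _≤?_)
open import Data.Nat.Induction using (<-rec)
open import Data.Nat.Properties using (≤-trans; ≮⇒≥)
open import Data.Fin using (Fin) renaming (zero to fzero; suc to fsuc)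
open import Data.Bool using (Bool; true; false)
open import Data.Maybe using (Maybe; just; nothing)
open import Data.Vec using ([]; _∷_; replicate)
open import Data.Vec.Relation.Binary.Pointwise.Inductive using (Pointwise; []; _∷_)
open import Data.Product using (∃; _,_)
open import Data.Unit using (⊤; tt)
open import Data.Empty using (⊥-elim)
open import Relation.Nullary using (¬_)
open import Relation.Nullary.Decidable using (decidable-stable)
open import Relation.Binary.PropositionalEquality
  using (_≡_; _≢_; refl; cong; subst; trans) renaming (sym to ≡-sym)
open import Function.Bundles using (_⇔_; mk⇔; Equivalence)
import Function.Properties.Equivalence as ⇔

private
  variable
    n d : ℕ

Consistent : Maybe Bool → Maybe Bool → Set
Consistent (just a) (just b) = a ≡ b
Consistent _        _        = ⊤

Compatible : Cube d → Cube d → Set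
Compatible = Pointwise Consistent

Admits : Bool → Maybe Bool → Set
Admits x m = ∀ b → m ≡ just b → x ≡ b

∈C-head : ∀ {x m} {xs : Point d} {c} → (x ∷ xs) ∈C (m ∷ c) → Admits x m
∈C-head x∈c = x∈c fzero

∈C-tail : ∀ {x m} {xs : Point d} {c} → (x ∷ xs) ∈C (m ∷ c) → xs ∈C c
∈C-tail x∈c j = x∈c (fsuc j)

∈C-∷ : ∀ {x m} {xs : Point d} {c} → Admits x m → xs ∈C c → (x ∷ xs) ∈C (m ∷ c)
∈C-∷ x∈m xs∈c fzero    = x∈m
∈C-∷ x∈m xs∈c (fsuc j) = xs∈c j

admits⇒consistent : ∀ x m m' → Admits x m → Admits x m' → Consistent m m'
admits⇒consistent x (just a) (just b) x∈m x∈m' = trans (≡-sym (x∈m a refl)) (x∈m' b refl)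
admits⇒consistent x (just _) nothing  _   _    = tt
admits⇒consistent x nothing  _        _   _    = tt

meets⇒compatible : (c c' : Cube d) → Meets c c' → Compatible c c'
meets⇒compatible []      []        _                    = []
meets⇒compatible (m ∷ c) (m' ∷ c') (x ∷ xs , x∈c , x∈c') =
  admits⇒consistent x m m' (∈C-head x∈c) (∈C-head x∈c')
    ∷ meets⇒compatible c c' (xs , ∈C-tail x∈c , ∈C-tail x∈c')

common : Maybe Bool → Maybe Bool → Bool
common (just a) _        = a
common nothing  (just b) = b
common nothing  nothing  = false

common-admits₁ : ∀ m m' → Admits (common m m') m
common-admits₁ (just a) _ _ refl = refl

common-admits₂ : ∀ m m' → Consistent m m' → Admits (common m m') m'
common-admits₂ (just a) (just _) a≡b _ refl = a≡b
common-admits₂ nothing  (just _) _   _ refl = refl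

compatible⇒meets : (c c' : Cube d) → Compatible c c' → Meets c c'
compatible⇒meets []      []        []       = [] , (λ ()) , (λ ())
compatible⇒meets (m ∷ c) (m' ∷ c') (k ∷ ks) with compatible⇒meets c c' ks
... | xs , xs∈c , xs∈c' =
  common m m' ∷ xs , ∈C-∷ (common-admits₁ m m') xs∈c , ∈C-∷ (common-admits₂ m m' k) xs∈c'

meets⇔compatible : (c c' : Cube d) → Meets c c' ⇔ Compatible c c'
meets⇔compatible c c' = mk⇔ (meets⇒compatible c c') (compatible⇒meets c c')

-- The subcube c ∩ w, as a subcube of the copy of Q_(dim w) spanned by the free
-- coordinates of w.
trace : (w : Cube d) → Cube d → Cube (dim w)
trace []            []      = []
trace (nothing ∷ w) (m ∷ c) = m ∷ trace w c
trace (just _ ∷ w)  (_ ∷ c) = trace w c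

trace-compatible : (w c c' : Cube d) → Compatible c c' → Compatible (trace w c) (trace w c')
trace-compatible []            []      []        []       = []
trace-compatible (nothing ∷ w) (_ ∷ c) (_ ∷ c') (k ∷ ks) = k ∷ trace-compatible w c c' ks
trace-compatible (just _ ∷ w)  (_ ∷ c) (_ ∷ c') (_ ∷ ks) = trace-compatible w c c' ks

-- The Helly property of subcubes, one coordinate at a time.
consistent-via-fixed : ∀ a m m' → Consistent (just a) m → Consistent (just a) m' → Consistent m m'
consistent-via-fixed a (just _) (just _) a≡b a≡b' = trans (≡-sym a≡b) a≡b'
consistent-via-fixed a (just _) nothing  _   _    = tt
consistent-via-fixed a nothing  _        _   _    = tt

trace-compatible⁻ : (w c c' : Cube d) → Compatible w c → Compatible w c' →
  Compatible (trace w c) (trace w c') → Compatible c c'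
trace-compatible⁻ []            []      []        []       []       []       = []
trace-compatible⁻ (nothing ∷ w) (_ ∷ c) (_ ∷ c') (_ ∷ wc) (_ ∷ wc') (k ∷ ks) =
  k ∷ trace-compatible⁻ w c c' wc wc' ks
trace-compatible⁻ (just a ∷ w)  (m ∷ c) (m' ∷ c') (k ∷ wc) (k' ∷ wc') ks =
  consistent-via-fixed a m m' k k' ∷ trace-compatible⁻ w c c' wc wc' ks

twin : Maybe Bool → Maybe Bool
twin nothing  = just false
twin (just _) = nothing

pad : Cube d → Cube (d * 2)
pad []      = []
pad (m ∷ c) = m ∷ twin m ∷ pad c

dim-pad : (c : Cube d) → dim (pad c) ≡ d
dim-pad []            = refl
dim-pad (nothing ∷ c) = cong suc (dim-pad c)
dim-pad (just _ ∷ c)  = cong suc (dim-pad c)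

twin-consistent : ∀ m m' → Consistent (twin m) (twin m')
twin-consistent nothing  nothing  = refl
twin-consistent nothing  (just _) = tt
twin-consistent (just _) _        = tt

pad-compatible⇔ : (c c' : Cube d) → Compatible c c' ⇔ Compatible (pad c) (pad c')
pad-compatible⇔ c c' = mk⇔ (to c c') (from c c')
  where
  to : (c c' : Cube d) → Compatible c c' → Compatible (pad c) (pad c')
  to []      []        []       = []
  to (m ∷ c) (m' ∷ c') (k ∷ ks) = k ∷ twin-consistent m m' ∷ to c c' ks

  from : (c c' : Cube d) → Compatible (pad c) (pad c') → Compatible c c'
  from []      []        []           = []
  from (_ ∷ c) (_ ∷ c') (k ∷ _ ∷ ks) = k ∷ from c c' ks

pad-meets⇔ : (c c' : Cube d) → Meets c c' ⇔ Meets (pad c) (pad c')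
pad-meets⇔ c c' =
  ⇔.trans (meets⇔compatible c c')
    (⇔.trans (pad-compatible⇔ c c') (⇔.sym (meets⇔compatible (pad c) (pad c'))))

full : (d : ℕ) → Cube d
full d = replicate d nothing

full-compatible : (c : Cube d) → Compatible (full d) c
full-compatible []      = []
full-compatible (_ ∷ c) = tt ∷ full-compatible c

full-meets : (c : Cube d) → Meets (full d) c
full-meets c = compatible⇒meets (full _) c (full-compatible c)

meets-sym : (c c' : Cube d) → Meets c c' → Meets c' c
meets-sym c c' (x , x∈c , x∈c') = x , x∈c' , x∈c

coneAdj : Graph n → Fin (suc n) → Fin (suc n) → Bool
coneAdj G fzero    fzero    = false
coneAdj G fzero    (fsuc _) = true
coneAdj G (fsuc _) fzero    = true
coneAdj G (fsuc u) (fsuc v) = adj G u v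

cone : Graph n → Graph (suc n)
cone G = record { adj = coneAdj G ; sym = coneSym ; irrefl = coneIrrefl }
  where
  coneSym : ∀ u v → coneAdj G u v ≡ coneAdj G v u
  coneSym fzero    fzero    = refl
  coneSym fzero    (fsuc _) = refl
  coneSym (fsuc _) fzero    = refl
  coneSym (fsuc u) (fsuc v) = sym G u v

  coneIrrefl : ∀ u → coneAdj G u u ≡ false
  coneIrrefl fzero    = refl
  coneIrrefl (fsuc u) = irrefl G u

fsuc-≢ : {u v : Fin n} → u ≢ v → fsuc u ≢ fsuc v
fsuc-≢ u≢v refl = u≢v refl

cone-uniformRep : (G : Graph n) → CubeRep G d → UniformRep (cone G) d
cone-uniformRep {n} {d} G (f , f-rep) = d * 2 , F , F-rep , dim-F
  where
  F : Fin (suc n) → Cube (d * 2)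
  F fzero    = pad (full d)
  F (fsuc u) = pad (f u)

  dim-F : ∀ v → dim (F v) ≡ d
  dim-F fzero    = dim-pad (full d)
  dim-F (fsuc u) = dim-pad (f u)

  F-rep : IsIntersectionGraph (cone G) F
  F-rep fzero    fzero    u≢u = ⊥-elim (u≢u refl)
  F-rep fzero    (fsuc v) _   =
    mk⇔ (λ _ → Equivalence.to (pad-meets⇔ (full d) (f v)) (full-meets (f v))) (λ _ → refl)
  F-rep (fsuc u) fzero    _   =
    mk⇔ (λ _ → Equivalence.to (pad-meets⇔ (f u) (full d))
                 (meets-sym (full d) (f u) (full-meets (f u))))
        (λ _ → refl)
  F-rep (fsuc u) (fsuc v) u≢v =
    ⇔.trans (f-rep u v λ u≡v → u≢v (cong fsuc u≡v)) (pad-meets⇔ (f u) (f v))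

uniformRep-cone⇒cubeRep : (G : Graph n) (r : ℕ) → UniformRep (cone G) r → CubeRep G r
uniformRep-cone⇒cubeRep {n} G r (d , F , F-rep , dim-F) =
  subst (CubeRep G) (dim-F fzero) (g , g-rep)
  where
  w : Cube d
  w = F fzero

  g : Fin n → Cube (dim w)
  g u = trace w (F (fsuc u))

  w-compatible : ∀ u → Compatible w (F (fsuc u))
  w-compatible u =
    meets⇒compatible w _ (Equivalence.to (F-rep fzero (fsuc u) (λ ())) refl)

  g-compatible⇔ : ∀ u v → Compatible (F (fsuc u)) (F (fsuc v)) ⇔ Compatible (g u) (g v)
  g-compatible⇔ u v = mk⇔ (trace-compatible w _ _)
    (trace-compatible⁻ w _ _ (w-compatible u) (w-compatible v))

  g-rep : IsIntersectionGraph G g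
  g-rep u v u≢v =
    ⇔.trans (F-rep (fsuc u) (fsuc v) (fsuc-≢ u≢v))
      (⇔.trans (meets⇔compatible _ _)
        (⇔.trans (g-compatible⇔ u v) (⇔.sym (meets⇔compatible (g u) (g v)))))

¬¬-least : (P : ℕ → Set) (m : ℕ) → P m → ¬ ¬ ∃ (IsLeast P)
¬¬-least P = <-rec _ λ m rec pm noLeast →
  noLeast (m , pm , λ k pk → ≮⇒≥ λ k<m → rec k<m pk noLeast)

mainTheorem2 : ∀ (n : ℕ) → n ≥ 1 → ∀ (a b : ℕ) →
    IsRhoN n a → IsTauN (suc n) b → a ≤ b
mainTheorem2 n _ a b ((G , repG , ρG-least) , _) (_ , τ-max) =
  -- τ(cone G) exists only up to double negation, which a ≤ b, being decidable, absorbs.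
  decidable-stable (a ≤? b) λ a≰b →
    ¬¬-least (UniformRep (cone G)) a (cone-uniformRep G repG)
      λ { (t , repH , τH-least) →
          a≰b (≤-trans (ρG-least t (uniformRep-cone⇒cubeRep G t repH))
                       (τ-max (cone G) t (repH , τH-least))) }
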